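{- Let $G$ be a finite, simple, connected graph and let $(G,\sigma)$ be a parity signed graph. Then a signed graph $(G,\sigma')$ is a parity signed graph if and only if it can be obtained from $(G,\sigma)$ by a sequence of parity-switches.
   Context: A signed graph $(G,\sigma)$ is a graph $G$ with a map $\sigma:E(G)\to\{1,-1\}$. For $G$ on $n$ vertices, $(G,\sigma)$ is a parity signed graph if there is a bijection $f:V(G)\to\{1,\dots,n\}$ (a parity-labeling) such that for every edge $uv$, $f(u),f(v)$ have the same parity if $\sigma(uv)=1$ and opposite parities if $\sigma(uv)=-1$. Switching at a vertex $v$ negates the sign of every edge incident with $v$. A parity-switch in a parity signed graph is switching (successively) at two vertices $u,v$ whose labels under a parity-labeling of the current parity signed graph have opposite parities. -}

module Defs where

open import Data.Nat using (ℕ; zero; suc)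
open import Data.Bool using (Bool; true; false; _∨_; not; if_then_else_)
open import Data.Fin using (Fin; toℕ; _≟_)
open import Data.Product using (Σ; ∃; _×_; _,_)
open import Relation.Nullary using (¬_)
open import Relation.Nullary.Decidable using (⌊_⌋)
open import Relation.Binary.PropositionalEquality using (_≡_)
open import Relation.Binary.Construct.Closure.ReflexiveTransitive using (Star)
open import Function.Definitions using (Bijective)

record Graph (n : ℕ) : Set₁ where
  field
    Adj     : Fin n → Fin n → Set
    sym     : ∀ {u v} → Adj u v → Adj v u
    irrefl  : ∀ {u} → ¬ Adj u u
open Graph public

Connected : ∀ {n} → Graph n → Set
Connected {n} G = ∀ (u v : Fin n) → Star (Adj G) u v

data Sign : Set where
  plus minus : Sign

neg : Sign → Sign
neg plus  = minus
neg minus = plus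

-- A signature assigns a sign to every ordered pair; only the values on edges matter.
Signature : ℕ → Set
Signature n = Fin n → Fin n → Sign

IsSigning : ∀ {n} → Graph n → Signature n → Set
IsSigning {n} G σ = ∀ (u v : Fin n) → Adj G u v → σ u v ≡ σ v u

-- Two signatures define the same signed graph on G if they agree on every edge.
SameOn : ∀ {n} → Graph n → Signature n → Signature n → Set
SameOn {n} G σ τ = ∀ (u v : Fin n) → Adj G u v → σ u v ≡ τ u v

isEven : ℕ → Bool
isEven zero    = true
isEven (suc k) = not (isEven k)

-- The label of v under f : Fin n → Fin n, read as a label in {1,…,n}.
label : ∀ {n} → (Fin n → Fin n) → Fin n → ℕ
label f v = suc (toℕ (f v))

SameParity : ℕ → ℕ → Set
SameParity a b = isEven a ≡ isEven b

OppositeParity : ℕ → ℕ → Set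
OppositeParity a b = isEven a ≡ not (isEven b)

IsParityLabeling : ∀ {n} → Graph n → Signature n → (Fin n → Fin n) → Set
IsParityLabeling {n} G σ f =
  Bijective _≡_ _≡_ f ×
  (∀ (u v : Fin n) → Adj G u v →
     (σ u v ≡ plus → SameParity (label f u) (label f v)) ×
     (σ u v ≡ minus → OppositeParity (label f u) (label f v)))

IsParitySigned : ∀ {n} → Graph n → Signature n → Set
IsParitySigned {n} G σ = Σ (Fin n → Fin n) (IsParityLabeling G σ)

switch : ∀ {n} → Fin n → Signature n → Signature n
switch v σ x y = if ⌊ x ≟ v ⌋ ∨ ⌊ y ≟ v ⌋ then neg (σ x y) else σ x y

ParitySwitch : ∀ {n} → Graph n → Signature n → Signature n → Set
ParitySwitch {n} G σ τ =
  Σ (Fin n → Fin n) λ f → Σ (Fin n) λ u → Σ (Fin n) λ v →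
    IsParityLabeling G σ f ×
    OppositeParity (label f u) (label f v) ×
    (τ ≡ switch v (switch u σ))

-- (G, τ) is obtained from (G, σ) by a sequence of parity-switches
-- (as signed graphs, i.e. up to agreement on the edges of G).
ObtainableByParitySwitches : ∀ {n} → Graph n → Signature n → Signature n → Set
ObtainableByParitySwitches {n} G σ σ' =
  Σ (Signature n) λ τ → Star (ParitySwitch G) σ τ × SameOn G τ σ'

-- A parity-labeling f of σ determines σ on every edge: the sign is + exactly when the
-- ends have labels of equal parity.  Switching at u and at v, where f u and f v have
-- opposite parities, yields the signature determined by f ∘ (u v), so parity-switches
-- realise exactly the transpositions of opposite-parity labels.  A transposition of two
-- labels of equal parity is the product (u w)(u v)(v w) of three such moves, with w any
-- vertex of the other parity.  Hence every bijection g labels some signature reachable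
-- from σ, which then agrees with any σ' labelled by g.
module Submission where

open import Defs hiding (sym)
open import Data.Nat using (ℕ; zero; suc)
open import Data.Bool using (Bool; true; false; not; _∧_; _∨_; _xor_; if_then_else_)
open import Data.Bool.Properties using (xor-∧-commutativeRing; xor-comm; not-¬; ¬-not)
  renaming (_≟_ to _≟ᵇ_)
open import Algebra.Bundles using (CommutativeRing)
open import Algebra.Properties.CommutativeSemigroup
  (CommutativeRing.+-commutativeSemigroup xor-∧-commutativeRing) using (interchange)
open import Data.Fin using (Fin; zero; suc; toℕ; _≟_)
import Data.Fin.Permutation as Permutation
open import Data.Fin.Permutation.Components using (transpose)
open import Data.Product using (∃; _×_; _,_; proj₁; proj₂)
open import Data.Empty using (⊥-elim)
open import Data.Sum using (inj₁; inj₂)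
open import Data.List using (List; []; _∷_; allFin)
open import Data.List.Relation.Unary.All using (All; []; _∷_) renaming (map to All-map; lookup to All-lookup)
open import Data.List.Membership.Propositional.Properties using (∈-allFin)
open import Function using (_∘_)
open import Function.Bundles using (Bijection)
open import Function.Definitions using (Injective; Bijective)
open import Function.Properties.Inverse using (Inverse⇒Bijection)
open import Function.Construct.Composition using () renaming (bijective to ∘-bijective)
open import Relation.Nullary using (yes; no)
open import Relation.Nullary.Decidable using (⌊_⌋; toSum)
open import Relation.Binary.PropositionalEquality
  using (_≡_; _≢_; _≗_; refl; sym; trans; cong; cong₂; module ≡-Reasoning)
open import Relation.Binary.Construct.Closure.ReflexiveTransitive using (Star; ε; _◅_; _◅◅_)

open ≡-Reasoning

negIf : Bool → Sign → Sign
negIf b s = if b then neg s else s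

negIf-negIf : ∀ b a s → negIf b (negIf a s) ≡ negIf (b xor a) s
negIf-negIf false a     s     = refl
negIf-negIf true  false s     = refl
negIf-negIf true  true  plus  = refl
negIf-negIf true  true  minus = refl

paritySign : Bool → Bool → Sign
paritySign a b = negIf (a xor b) plus

paritySign-xor : ∀ c d a b → paritySign (c xor a) (d xor b) ≡ negIf (c xor d) (paritySign a b)
paritySign-xor c d a b = begin
  negIf ((c xor a) xor (d xor b)) plus  ≡⟨ cong (λ e → negIf e plus) (interchange c a d b) ⟩
  negIf ((c xor d) xor (a xor b)) plus  ≡⟨ negIf-negIf (c xor d) (a xor b) plus ⟨
  negIf (c xor d) (paritySign a b)         ∎

paritySign⇒edgeCondition : ∀ {s} a b → s ≡ paritySign a b →
                        (s ≡ plus → a ≡ b) × (s ≡ minus → a ≡ not b)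
paritySign⇒edgeCondition true  true  refl = (λ _ → refl) , λ ()
paritySign⇒edgeCondition false false refl = (λ _ → refl) , λ ()
paritySign⇒edgeCondition true  false refl = (λ ()) , λ _ → refl
paritySign⇒edgeCondition false true  refl = (λ ()) , λ _ → refl

edgeCondition⇒paritySign : ∀ s a b → (s ≡ plus → a ≡ b) → (s ≡ minus → a ≡ not b) →
                        s ≡ paritySign a b
edgeCondition⇒paritySign plus a b same _ with same refl
... | refl with a
...   | true  = refl
...   | false = refl
edgeCondition⇒paritySign minus a b _ opposite with opposite refl
... | refl with b
...   | true  = refl
...   | false = refl

≡not-sym : ∀ {a b} → a ≡ not b → b ≡ not a
≡not-sym {true}  {false} refl = refl
≡not-sym {false} {true}  refl = refl

∨-disjoint : ∀ a b → a ∧ b ≡ false → a ∨ b ≡ a xor b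
∨-disjoint false _     _ = refl
∨-disjoint true  false _ = refl

≟-distinct-sources : ∀ {n} {x y : Fin n} (w : Fin n) → x ≢ y → ⌊ x ≟ w ⌋ ∧ ⌊ y ≟ w ⌋ ≡ false
≟-distinct-sources {x = x} {y} w x≢y with x ≟ w | y ≟ w
... | yes refl | yes refl = ⊥-elim (x≢y refl)
... | yes _    | no _     = refl
... | no _     | _        = refl

≟-distinct-targets : ∀ {n} {u v : Fin n} (x : Fin n) → u ≢ v → ⌊ x ≟ u ⌋ ∧ ⌊ x ≟ v ⌋ ≡ false
≟-distinct-targets {u = u} {v} x u≢v with x ≟ u | x ≟ v
... | yes refl | yes refl = ⊥-elim (u≢v refl)
... | yes _    | no _     = refl
... | no _     | _        = refl

parity : ∀ {n} → (Fin n → Fin n) → Fin n → Bool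
parity f v = isEven (label f v)

parity-cong : ∀ {n} {f g : Fin n → Fin n} → f ≗ g → parity f ≗ parity g
parity-cong f≗g z = cong (λ l → isEven (suc (toℕ l))) (f≗g z)

bijective-cong : ∀ {A B : Set} {f g : A → B} → f ≗ g → Bijective _≡_ _≡_ f → Bijective _≡_ _≡_ g
bijective-cong {f = f} {g} f≗g (f-inj , f-surj) = g-inj , g-surj
  where
  g-inj : ∀ {x y} → g x ≡ g y → x ≡ y
  g-inj {x} {y} e = f-inj (trans (f≗g x) (trans e (sym (f≗g y))))
  g-surj : ∀ l → ∃ λ w → ∀ {z} → z ≡ w → g z ≡ l
  g-surj l with f-surj l
  ... | w , fw = w , λ {z} z≡w → trans (sym (f≗g z)) (fw z≡w)

labelOfParity : ∀ {n} {u v : Fin n} → u ≢ v → ∀ c → ∃ λ (l : Fin n) → isEven (suc (toℕ l)) ≡ c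
labelOfParity {suc (suc _)} _ false = zero , refl
labelOfParity {suc (suc _)} _ true  = suc zero , refl
labelOfParity {suc zero} {zero} {zero} u≢v _ = ⊥-elim (u≢v refl)

vertexOfParity : ∀ {n} {f : Fin n → Fin n} {u v : Fin n} → Bijective _≡_ _≡_ f → u ≢ v →
  ∀ c → ∃ λ w → parity f w ≡ c
vertexOfParity (_ , f-surj) u≢v c with labelOfParity u≢v c
... | l , pl with f-surj l
...   | w , fw = w , trans (cong (λ k → isEven (suc (toℕ k))) (fw refl)) pl

transpose-matchˡ : ∀ {n} (u v : Fin n) → transpose u v u ≡ v
transpose-matchˡ u v with u ≟ u
... | yes _   = refl
... | no u≢u = ⊥-elim (u≢u refl)

transpose-matchʳ : ∀ {n} (u v : Fin n) → transpose u v v ≡ u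
transpose-matchʳ u v with v ≟ u
... | yes v≡u = v≡u
... | no _ with v ≟ v
...   | yes _   = refl
...   | no v≢v = ⊥-elim (v≢v refl)

transpose-other : ∀ {n} {u v z : Fin n} → z ≢ u → z ≢ v → transpose u v z ≡ z
transpose-other {u = u} {v} {z} z≢u z≢v with z ≟ u
... | yes z≡u = ⊥-elim (z≢u z≡u)
... | no _ with z ≟ v
...   | yes z≡v = ⊥-elim (z≢v z≡v)
...   | no _    = refl

transpose-diagonal : ∀ {n} (u z : Fin n) → transpose u u z ≡ z
transpose-diagonal u z with z ≟ u
... | yes z≡u = sym z≡u
... | no z≢u with z ≟ u
...   | yes z≡u = ⊥-elim (z≢u z≡u)
...   | no _    = refl

transpose-conjugate : ∀ {n} {u v w : Fin n} → u ≢ v → u ≢ w → v ≢ w →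
  ∀ z → transpose u w (transpose u v (transpose v w z)) ≡ transpose u v z
transpose-conjugate {u = u} {v} {w} u≢v u≢w v≢w z with toSum (z ≟ u)
... | inj₁ refl = begin
  transpose z w (transpose z v (transpose v w z)) ≡⟨ cong (transpose z w ∘ transpose z v) (transpose-other u≢v u≢w) ⟩
  transpose z w (transpose z v z)                 ≡⟨ cong (transpose z w) (transpose-matchˡ z v) ⟩
  transpose z w v                                 ≡⟨ transpose-other (u≢v ∘ sym) v≢w ⟩
  v                                               ≡⟨ transpose-matchˡ z v ⟨
  transpose z v z                                 ∎
... | inj₂ z≢u with toSum (z ≟ v)
...   | inj₁ refl = begin
  transpose u w (transpose u z (transpose z w z)) ≡⟨ cong (transpose u w ∘ transpose u z) (transpose-matchˡ z w) ⟩
  transpose u w (transpose u z w)                 ≡⟨ cong (transpose u w) (transpose-other (u≢w ∘ sym) (v≢w ∘ sym)) ⟩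
  transpose u w w                                 ≡⟨ transpose-matchʳ u w ⟩
  u                                               ≡⟨ transpose-matchʳ u z ⟨
  transpose u z z                                 ∎
...   | inj₂ z≢v with toSum (z ≟ w)
...     | inj₁ refl = begin
  transpose u z (transpose u v (transpose v z z)) ≡⟨ cong (transpose u z ∘ transpose u v) (transpose-matchʳ v z) ⟩
  transpose u z (transpose u v v)                 ≡⟨ cong (transpose u z) (transpose-matchʳ u v) ⟩
  transpose u z u                                 ≡⟨ transpose-matchˡ u z ⟩
  z                                               ≡⟨ transpose-other z≢u z≢v ⟨
  transpose u v z                                 ∎
...     | inj₂ z≢w = begin
  transpose u w (transpose u v (transpose v w z)) ≡⟨ cong (transpose u w ∘ transpose u v) (transpose-other z≢v z≢w) ⟩
  transpose u w (transpose u v z)                 ≡⟨ cong (transpose u w) (transpose-other z≢u z≢v) ⟩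
  transpose u w z                                 ≡⟨ transpose-other z≢u z≢w ⟩
  z                                               ≡⟨ transpose-other z≢u z≢v ⟨
  transpose u v z                                 ∎

transpose-bijective : ∀ {n} (u v : Fin n) → Bijective _≡_ _≡_ (transpose u v)
transpose-bijective u v = Bijection.bijective (Inverse⇒Bijection (Permutation.transpose u v))

inPair : ∀ {n} → Fin n → Fin n → Fin n → Bool
inPair u v z = ⌊ z ≟ u ⌋ ∨ ⌊ z ≟ v ⌋

parity-transpose : ∀ {n} (f : Fin n → Fin n) {u v} → parity f u ≡ not (parity f v) →
  ∀ z → parity (f ∘ transpose u v) z ≡ inPair u v z xor parity f z
parity-transpose f {u} {v} opp z with z ≟ u
... | yes refl = ≡not-sym opp
... | no _ with z ≟ v
...   | yes refl = opp
...   | no _     = refl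

-- With u ≠ v and x ≠ y every disjunction of two of the tests ⌊ x ≟ u ⌋, ⌊ y ≟ u ⌋,
-- ⌊ x ≟ v ⌋, ⌊ y ≟ v ⌋ used here is exclusive, hence a xor that can be regrouped freely.
switch-switch : ∀ {n} (σ : Signature n) {u v x y : Fin n} → u ≢ v → x ≢ y →
  switch v (switch u σ) x y ≡ negIf (inPair u v x xor inPair u v y) (σ x y)
switch-switch σ {u} {v} {x} {y} u≢v x≢y = begin
  negIf (xv ∨ yv) (negIf (xu ∨ yu) (σ x y))   ≡⟨ negIf-negIf (xv ∨ yv) (xu ∨ yu) (σ x y) ⟩
  negIf ((xv ∨ yv) xor (xu ∨ yu)) (σ x y)     ≡⟨ cong (λ e → negIf e (σ x y)) reorder ⟩
  negIf ((xu ∨ xv) xor (yu ∨ yv)) (σ x y)     ∎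
  where
  xu = ⌊ x ≟ u ⌋
  xv = ⌊ x ≟ v ⌋
  yu = ⌊ y ≟ u ⌋
  yv = ⌊ y ≟ v ⌋
  reorder : (xv ∨ yv) xor (xu ∨ yu) ≡ (xu ∨ xv) xor (yu ∨ yv)
  reorder = begin
    (xv ∨ yv) xor (xu ∨ yu)
      ≡⟨ cong₂ _xor_ (∨-disjoint xv yv (≟-distinct-sources v x≢y))
                     (∨-disjoint xu yu (≟-distinct-sources u x≢y)) ⟩
    (xv xor yv) xor (xu xor yu)   ≡⟨ interchange xv yv xu yu ⟩
    (xv xor xu) xor (yv xor yu)   ≡⟨ cong₂ _xor_ (xor-comm xv xu) (xor-comm yv yu) ⟩
    (xu xor xv) xor (yu xor yv)
      ≡⟨ cong₂ _xor_ (∨-disjoint xu xv (≟-distinct-targets x u≢v))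
                     (∨-disjoint yu yv (≟-distinct-targets y u≢v)) ⟨
    (xu ∨ xv) xor (yu ∨ yv)       ∎

module _ {n : ℕ} (G : Graph n) where

  SignedByParity : Signature n → (Fin n → Fin n) → Set
  SignedByParity σ f = ∀ (u v : Fin n) → Adj G u v → σ u v ≡ paritySign (parity f u) (parity f v)

  labeling⇒signedByParity : ∀ {σ f} → IsParityLabeling G σ f → SignedByParity σ f
  labeling⇒signedByParity {σ} {f} (_ , edges) u v e =
    edgeCondition⇒paritySign (σ u v) (parity f u) (parity f v) (proj₁ (edges u v e)) (proj₂ (edges u v e))

  signedByParity⇒labeling : ∀ {σ f} → Bijective _≡_ _≡_ f → SignedByParity σ f → IsParityLabeling G σ f
  signedByParity⇒labeling {f = f} bij signed =
    bij , λ u v e → paritySign⇒edgeCondition (parity f u) (parity f v) (signed u v e)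

  labeling-cong : ∀ {σ f g} → f ≗ g → IsParityLabeling G σ f → IsParityLabeling G σ g
  labeling-cong f≗g L = signedByParity⇒labeling (bijective-cong f≗g (proj₁ L)) λ u v e →
    trans (labeling⇒signedByParity L u v e) (cong₂ paritySign (parity-cong f≗g u) (parity-cong f≗g v))

  labeling-sameOn : ∀ {σ τ f} → SameOn G σ τ → IsParityLabeling G σ f → IsParityLabeling G τ f
  labeling-sameOn σ≐τ L = signedByParity⇒labeling (proj₁ L) λ u v e →
    trans (sym (σ≐τ u v e)) (labeling⇒signedByParity L u v e)

  sameOn-commonLabeling : ∀ {σ τ f} → IsParityLabeling G σ f → IsParityLabeling G τ f → SameOn G σ τ
  sameOn-commonLabeling Lσ Lτ u v e =
    trans (labeling⇒signedByParity Lσ u v e) (sym (labeling⇒signedByParity Lτ u v e))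

  labeling-transpose : ∀ {σ f u v} → IsParityLabeling G σ f → parity f u ≡ not (parity f v) →
    IsParityLabeling G (switch v (switch u σ)) (f ∘ transpose u v)
  labeling-transpose {σ} {f} {u} {v} L opp =
    signedByParity⇒labeling (∘-bijective _≡_ _≡_ _≡_ (transpose-bijective u v) (proj₁ L)) signed
    where
    u≢v : u ≢ v
    u≢v refl = not-¬ refl opp
    signed : SignedByParity (switch v (switch u σ)) (f ∘ transpose u v)
    signed x y e = begin
      switch v (switch u σ) x y                                 ≡⟨ switch-switch σ u≢v x≢y ⟩
      negIf (inPair u v x xor inPair u v y) (σ x y)             ≡⟨ cong (negIf _) (labeling⇒signedByParity L x y e) ⟩
      negIf (inPair u v x xor inPair u v y) (paritySign (parity f x) (parity f y))
        ≡⟨ paritySign-xor (inPair u v x) (inPair u v y) (parity f x) (parity f y) ⟨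
      paritySign (inPair u v x xor parity f x) (inPair u v y xor parity f y)
        ≡⟨ cong₂ paritySign (parity-transpose f opp x) (parity-transpose f opp y) ⟨
      paritySign (parity (f ∘ transpose u v) x) (parity (f ∘ transpose u v) y)  ∎
      where
      x≢y : x ≢ y
      x≢y refl = irrefl G e

  labeling-alongSwitches : ∀ {σ τ} → Star (ParitySwitch G) σ τ → IsParitySigned G σ → IsParitySigned G τ
  labeling-alongSwitches ε                                      L = L
  labeling-alongSwitches ((f , u , v , Lf , opp , refl) ◅ steps) _ =
    labeling-alongSwitches steps (f ∘ transpose u v , labeling-transpose Lf opp)

  ReachesLabeling : Signature n → (Fin n → Fin n) → Set
  ReachesLabeling σ g = ∃ λ τ → Star (ParitySwitch G) σ τ × IsParityLabeling G τ g

  reaches-trans : ∀ {σ f g} → ReachesLabeling σ f →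
    (∀ {τ} → IsParityLabeling G τ f → ReachesLabeling τ g) → ReachesLabeling σ g
  reaches-trans (τ , steps , L) continue with continue L
  ... | τ' , steps' , L' = τ' , steps ◅◅ steps' , L'

  reaches-cong : ∀ {σ f g} → f ≗ g → ReachesLabeling σ f → ReachesLabeling σ g
  reaches-cong f≗g (τ , steps , L) = τ , steps , labeling-cong f≗g L

  reaches-oppositeTranspose : ∀ {σ f u v} → IsParityLabeling G σ f → parity f u ≡ not (parity f v) →
    ReachesLabeling σ (f ∘ transpose u v)
  reaches-oppositeTranspose {f = f} {u} {v} L opp =
    _ , (f , u , v , L , opp , refl) ◅ ε , labeling-transpose L opp

  reaches-transpose : ∀ {σ f} → IsParityLabeling G σ f → ∀ u v → ReachesLabeling σ (f ∘ transpose u v)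
  reaches-transpose {σ} {f} L u v with toSum (u ≟ v)
  ... | inj₁ refl = reaches-cong (λ z → cong f (sym (transpose-diagonal u z))) (σ , ε , L)
  ... | inj₂ u≢v with parity f u ≟ᵇ parity f v
  ...   | no differ = reaches-oppositeTranspose L (¬-not differ)
  ...   | yes same  with vertexOfParity (proj₁ L) u≢v (not (parity f u))
  ...     | w , fw≡¬fu =
    reaches-trans (reaches-oppositeTranspose L (≡not-sym fw≡¬fu)) λ L₁ →
    reaches-trans (reaches-oppositeTranspose L₁ opp₁) λ L₂ →
    reaches-cong (λ z → cong f (transpose-conjugate u≢v u≢w v≢w z))
                 (reaches-oppositeTranspose L₂ opp₂)
    where
    u≢w : u ≢ w
    u≢w refl = not-¬ refl fw≡¬fu
    v≢w : v ≢ w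
    v≢w refl = not-¬ refl (trans same fw≡¬fu)
    f₁ = f ∘ transpose u w
    opp₁ : parity f₁ u ≡ not (parity f₁ v)
    opp₁ = begin
      parity f₁ u         ≡⟨ cong (parity f) (transpose-matchˡ u w) ⟩
      parity f w          ≡⟨ fw≡¬fu ⟩
      not (parity f u)    ≡⟨ cong not same ⟩
      not (parity f v)    ≡⟨ cong (not ∘ parity f) (transpose-other (u≢v ∘ sym) v≢w) ⟨
      not (parity f₁ v)   ∎
    f₂ = f₁ ∘ transpose u v
    opp₂ : parity f₂ v ≡ not (parity f₂ w)
    opp₂ = begin
      parity f₂ v         ≡⟨ cong (parity f₁) (transpose-matchʳ u v) ⟩
      parity f₁ u         ≡⟨ cong (parity f) (transpose-matchˡ u w) ⟩
      parity f w          ≡⟨ fw≡¬fu ⟩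
      not (parity f u)    ≡⟨ cong (not ∘ parity f) (transpose-matchʳ u w) ⟨
      not (parity f₁ w)   ≡⟨ cong (not ∘ parity f₁) (transpose-other (u≢w ∘ sym) (v≢w ∘ sym)) ⟨
      not (parity f₂ w)   ∎

  reaches-agreeing : ∀ {σ f g} → IsParityLabeling G σ f → Injective _≡_ _≡_ g →
    (xs : List (Fin n)) → ∃ λ h → ReachesLabeling σ h × All (λ z → h z ≡ g z) xs
  reaches-agreeing L g-inj [] = _ , (_ , ε , L) , []
  reaches-agreeing {g = g} L g-inj (x ∷ xs) with reaches-agreeing L g-inj xs
  ... | h , reach@(_ , _ , Lh) , agree with proj₂ (proj₁ Lh) (g x)
  ...   | y , hy =
    h ∘ transpose x y , reaches-trans reach (λ L′ → reaches-transpose L′ x y) ,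
    fixes-x ∷ All-map fixes-agreement agree
    where
    fixes-x : h (transpose x y x) ≡ g x
    fixes-x = trans (cong h (transpose-matchˡ x y)) (hy refl)
    fixes-agreement : ∀ {z} → h z ≡ g z → h (transpose x y z) ≡ g z
    fixes-agreement {z} hz≡gz with toSum (z ≟ x)
    ... | inj₁ refl = fixes-x
    ... | inj₂ z≢x with toSum (z ≟ y)
    ...   | inj₁ refl = ⊥-elim (z≢x (g-inj (trans (sym hz≡gz) (hy refl))))
    ...   | inj₂ z≢y  = trans (cong h (transpose-other z≢x z≢y)) hz≡gz

  reaches-every : ∀ {σ f g} → IsParityLabeling G σ f → Injective _≡_ _≡_ g → ReachesLabeling σ g
  reaches-every L g-inj with reaches-agreeing L g-inj (allFin n)
  ... | h , reach , agree = reaches-cong (λ z → All-lookup agree (∈-allFin z)) reach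

proposition3 : ∀ (n : ℕ) (G : Graph n) → Connected G →
    (σ : Signature n) → IsSigning G σ → IsParitySigned G σ →
    (σ' : Signature n) → IsSigning G σ' →
    (IsParitySigned G σ' → ObtainableByParitySwitches G σ σ') ×
    (ObtainableByParitySwitches G σ σ' → IsParitySigned G σ')
proposition3 n G _ σ _ (f , L) σ' _ = obtainable , parity-signed
  where
  obtainable : IsParitySigned G σ' → ObtainableByParitySwitches G σ σ'
  obtainable (g , Lg) with reaches-every G L (proj₁ (proj₁ Lg))
  ... | τ , steps , Lτ = τ , steps , sameOn-commonLabeling G Lτ Lg
  parity-signed : ObtainableByParitySwitches G σ σ' → IsParitySigned G σ'
  parity-signed (τ , steps , τ≐σ') with labeling-alongSwitches G steps (f , L)
  ... | h , Lh = h , labeling-sameOn G τ≐σ' Lh
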